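{- Let $x, y \in \mathbb{Z}$ and let $p \geq 3$ be a prime such that $x^2 - 2 = y^p$. Then there exist $a, b, r \in \mathbb{Z}$ with $|r| \leq \frac{p-1}{2}$ such that $$x + \sqrt{2} = (1+\sqrt{2})^r (a + b\sqrt{2})^p.$$ Consequently, $a$ and $b$ satisfy $$\frac{1}{2\sqrt{2}}\left((1+\sqrt{2})^r (a+b\sqrt{2})^p - (1-\sqrt{2})^r (a-b\sqrt{2})^p\right) = 1.$$ -}

module Defs where

open import Data.Nat using (ℕ; zero; suc)
open import Data.Integer using (ℤ; +_; -[1+_]; _+_; _*_; -_; _-_)
open import Data.Product using (_×_; _,_)

record ℤ√2 : Set where
  constructor _+_√2
  field
    re : ℤ
    im : ℤ
open ℤ√2 public

_·_ : ℤ√2 → ℤ√2 → ℤ√2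
(a + b √2) · (c + d √2) = (a * c + + 2 * (b * d)) + (a * d + b * c) √2

one : ℤ√2
one = (+ 1) + (+ 0) √2

_^ₙ_ : ℤ√2 → ℕ → ℤ√2
α ^ₙ zero = one
α ^ₙ suc n = α · (α ^ₙ n)

conj : ℤ√2 → ℤ√2
conj (a + b √2) = a + (- b) √2

_⊖_ : ℤ√2 → ℤ√2 → ℤ√2
(a + b √2) ⊖ (c + d √2) = (a - c) + (b - d) √2

ε : ℤ√2
ε = (+ 1) + (+ 1) √2

ε⁻¹ : ℤ√2
ε⁻¹ = (- + 1) + (+ 1) √2

εpow : ℤ → ℤ√2
εpow (+ n) = ε ^ₙ n
εpow -[1+ n ] = ε⁻¹ ^ₙ suc n

εbarpow : ℤ → ℤ√2
εbarpow r = conj (εpow r)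

{-# OPTIONS --safe #-}

-- ℤ[√2] is norm-Euclidean, so a factor of a perfect power that is comaximal with its cofactor is a
-- unit times a perfect power (induct on the norm, splitting off the gcd with the base).  If
-- x² − 2 = yᵖ then x is odd, which makes α = x + √2 and ᾱ = x − √2 comaximal; as αᾱ = yᵖ, α = w δᵖ
-- with w a unit.  A descent on a² − 2b² = ±1 shows the units are ±(1 + √2)ʳ.  Since p is odd the
-- sign goes into δ, and writing r = qp + r′ with |r′| ≤ (p − 1)/2 moves (1 + √2)^(qp) into δ as well.
-- The second identity is α − ᾱ = 2√2 with ᾱ computed from the first by conjugation.

module Submission where

open import Defs
open import Data.Nat using (ℕ; _≤_; _∸_; _/_)
open import Data.Nat.Primality using (Prime)
open import Data.Integer using (ℤ; +_; -_; _-_; _*_; _^_; ∣_∣)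
open import Data.Product using (_×_; ∃-syntax)
open import Relation.Binary.PropositionalEquality using (_≡_)

open import Algebra.Bundles using (CommutativeRing)
open import Algebra.Structures {A = ℤ√2} _≡_ using (IsCommutativeRing)
open import Data.Empty using (⊥; ⊥-elim)
import Data.Integer as ℤ
open import Data.Integer using (-[1+_])
open import Data.Integer.DivMod using (a≡a%ℕn+[a/ℕn]*n; n%ℕd<d)
import Data.Integer.Properties as ℤP
import Data.Integer.Tactic.RingSolver as ℤ-Solver
open import Data.List using (_∷_; [])
open import Data.Maybe using (Maybe; just; nothing)
import Data.Nat as ℕ
open import Data.Nat using (zero; suc; _<_; z≤n; s≤s)
open import Data.Nat.DivMod using (m%n<n; m≡m%n+[m/n]*n; m*n/n≡m)
open import Data.Nat.Divisibility using (divides)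
open import Data.Nat.Induction using (<-wellFounded)
open import Data.Nat.Primality using (euclidsLemma; prime[2]; prime⇒irreducible)
import Data.Nat.Properties as ℕP
import Data.Nat.Tactic.RingSolver as ℕ-Solver
open import Data.Product using (_,_; map; uncurry)
open import Data.Sum using (_⊎_; inj₁; inj₂; [_,_]′)
open import Function using (_∘_; _on_; id)
open import Induction.WellFounded using (WellFounded; Acc; acc)
open import Relation.Binary.Construct.On using () renaming (wellFounded to on-wellFounded)
open import Relation.Binary.PropositionalEquality
  using (_≢_; refl; sym; trans; cong; cong₂; subst; subst₂; isEquivalence; module ≡-Reasoning)
open import Relation.Nullary using (yes; no; contradiction)
import Tactic.RingSolver as Solver
open import Tactic.RingSolver.Core.AlmostCommutativeRing using (AlmostCommutativeRing; fromCommutativeRing)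

infixl 6 _⊕_
_⊕_ : ℤ√2 → ℤ√2 → ℤ√2
(a + b √2) ⊕ (c + d √2) = (a ℤ.+ c) + (b ℤ.+ d) √2

neg : ℤ√2 → ℤ√2
neg (a + b √2) = (- a) + (- b) √2

fromℤ : ℤ → ℤ√2
fromℤ n = n + (+ 0) √2

𝟘 : ℤ√2
𝟘 = fromℤ (+ 0)

⊕-assoc : ∀ x y z → (x ⊕ y) ⊕ z ≡ x ⊕ (y ⊕ z)
⊕-assoc (a + b √2) (c + d √2) (e + f √2) = cong₂ _+_√2 (law a c e) (law b d f)
  where law : ∀ a c e → (a ℤ.+ c) ℤ.+ e ≡ a ℤ.+ (c ℤ.+ e)
        law = ℤ-Solver.solve-∀

⊕-comm : ∀ x y → x ⊕ y ≡ y ⊕ x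
⊕-comm (a + b √2) (c + d √2) = cong₂ _+_√2 (law a c) (law b d)
  where law : ∀ a c → a ℤ.+ c ≡ c ℤ.+ a
        law = ℤ-Solver.solve-∀

⊕-identityˡ : ∀ x → 𝟘 ⊕ x ≡ x
⊕-identityˡ (a + b √2) = cong₂ _+_√2 (law a) (law b)
  where law : ∀ a → + 0 ℤ.+ a ≡ a
        law = ℤ-Solver.solve-∀

⊕-identityʳ : ∀ x → x ⊕ 𝟘 ≡ x
⊕-identityʳ x = trans (⊕-comm x 𝟘) (⊕-identityˡ x)

neg-inverseˡ : ∀ x → neg x ⊕ x ≡ 𝟘
neg-inverseˡ (a + b √2) = cong₂ _+_√2 (law a) (law b)
  where law : ∀ a → - a ℤ.+ a ≡ + 0
        law = ℤ-Solver.solve-∀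

neg-inverseʳ : ∀ x → x ⊕ neg x ≡ 𝟘
neg-inverseʳ x = trans (⊕-comm x (neg x)) (neg-inverseˡ x)

·-assoc : ∀ x y z → (x · y) · z ≡ x · (y · z)
·-assoc (a + b √2) (c + d √2) (e + f √2) = cong₂ _+_√2 (re-law a b c d e f) (im-law a b c d e f)
  where
  re-law : ∀ a b c d e f → (a * c ℤ.+ + 2 * (b * d)) * e ℤ.+ + 2 * ((a * d ℤ.+ b * c) * f)
                         ≡ a * (c * e ℤ.+ + 2 * (d * f)) ℤ.+ + 2 * (b * (c * f ℤ.+ d * e))
  re-law = ℤ-Solver.solve-∀
  im-law : ∀ a b c d e f → (a * c ℤ.+ + 2 * (b * d)) * f ℤ.+ (a * d ℤ.+ b * c) * e
                         ≡ a * (c * f ℤ.+ d * e) ℤ.+ b * (c * e ℤ.+ + 2 * (d * f))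
  im-law = ℤ-Solver.solve-∀

·-comm : ∀ x y → x · y ≡ y · x
·-comm (a + b √2) (c + d √2) = cong₂ _+_√2 (re-law a b c d) (im-law a b c d)
  where
  re-law : ∀ a b c d → a * c ℤ.+ + 2 * (b * d) ≡ c * a ℤ.+ + 2 * (d * b)
  re-law = ℤ-Solver.solve-∀
  im-law : ∀ a b c d → a * d ℤ.+ b * c ≡ c * b ℤ.+ d * a
  im-law = ℤ-Solver.solve-∀

·-identityˡ : ∀ x → one · x ≡ x
·-identityˡ (a + b √2) = cong₂ _+_√2 (re-law a b) (im-law a b)
  where
  re-law : ∀ a b → + 1 * a ℤ.+ + 2 * (+ 0 * b) ≡ a
  re-law = ℤ-Solver.solve-∀
  im-law : ∀ a b → + 1 * b ℤ.+ + 0 * a ≡ b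
  im-law = ℤ-Solver.solve-∀

·-identityʳ : ∀ x → x · one ≡ x
·-identityʳ x = trans (·-comm x one) (·-identityˡ x)

·-distribˡ : ∀ x y z → x · (y ⊕ z) ≡ x · y ⊕ x · z
·-distribˡ (a + b √2) (c + d √2) (e + f √2) = cong₂ _+_√2 (re-law a b c d e f) (im-law a b c d e f)
  where
  re-law : ∀ a b c d e f → a * (c ℤ.+ e) ℤ.+ + 2 * (b * (d ℤ.+ f))
                         ≡ (a * c ℤ.+ + 2 * (b * d)) ℤ.+ (a * e ℤ.+ + 2 * (b * f))
  re-law = ℤ-Solver.solve-∀
  im-law : ∀ a b c d e f → a * (d ℤ.+ f) ℤ.+ b * (c ℤ.+ e) ≡ (a * d ℤ.+ b * c) ℤ.+ (a * f ℤ.+ b * e)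
  im-law = ℤ-Solver.solve-∀

·-distribʳ : ∀ x y z → (y ⊕ z) · x ≡ y · x ⊕ z · x
·-distribʳ x y z = trans (·-comm (y ⊕ z) x) (trans (·-distribˡ x y z) (cong₂ _⊕_ (·-comm x y) (·-comm x z)))

ℤ√2-isCommutativeRing : IsCommutativeRing _⊕_ _·_ neg 𝟘 one
ℤ√2-isCommutativeRing = record
  { isRing = record
    { +-isAbelianGroup = record
      { isGroup = record
        { isMonoid = record
          { isSemigroup = record
            { isMagma = record { isEquivalence = isEquivalence ; ∙-cong = cong₂ _⊕_ }
            ; assoc = ⊕-assoc }
          ; identity = ⊕-identityˡ , ⊕-identityʳ }
        ; inverse = neg-inverseˡ , neg-inverseʳ
        ; ⁻¹-cong = cong neg }
      ; comm = ⊕-comm }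
    ; *-cong = cong₂ _·_
    ; *-assoc = ·-assoc
    ; *-identity = ·-identityˡ , ·-identityʳ
    ; distrib = ·-distribˡ , ·-distribʳ }
  ; *-comm = ·-comm }

ℤ√2-commutativeRing : CommutativeRing _ _
ℤ√2-commutativeRing = record { isCommutativeRing = ℤ√2-isCommutativeRing }

-- Without a zero test the solver keeps cancelled monomials (coefficient 1 ⊕ neg 1) and fails on
-- identities such as a ≡ b ⊕ (a ⊕ neg b).
ℤ√2-ring : AlmostCommutativeRing _ _
ℤ√2-ring = fromCommutativeRing ℤ√2-commutativeRing 𝟘≟_
  where
  𝟘≟_ : ∀ x → Maybe (𝟘 ≡ x)
  𝟘≟ ((+ 0) + (+ 0) √2) = just refl
  𝟘≟ _ = nothing

open CommutativeRing ℤ√2-commutativeRing using (zeroˡ; commutativeSemiring; ring; *-commutativeSemigroup)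
open import Algebra.Properties.CommutativeSemiring.Exp commutativeSemiring
  using (^-homo-*; ^-assocʳ; ^-distrib-*) renaming (_^_ to _^ᴿ_)
open import Algebra.Properties.Ring ring using (x∙y⁻¹≈ε⇒x≈y; -‿involutive; -‿distribˡ-*; -‿distribʳ-*)
open import Algebra.Properties.CommutativeSemigroup.Divisibility *-commutativeSemigroup using (_∣_; _,_)

^ₙ≡^ᴿ : ∀ x n → x ^ₙ n ≡ x ^ᴿ n
^ₙ≡^ᴿ x zero = refl
^ₙ≡^ᴿ x (suc n) = cong (x ·_) (^ₙ≡^ᴿ x n)

^ₙ-homo-· : ∀ x m n → x ^ₙ (m ℕ.+ n) ≡ (x ^ₙ m) · (x ^ₙ n)
^ₙ-homo-· x m n rewrite ^ₙ≡^ᴿ x (m ℕ.+ n) | ^ₙ≡^ᴿ x m | ^ₙ≡^ᴿ x n = ^-homo-* x m n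

^ₙ-assocʳ : ∀ x m n → (x ^ₙ m) ^ₙ n ≡ x ^ₙ (m ℕ.* n)
^ₙ-assocʳ x m n rewrite ^ₙ≡^ᴿ (x ^ₙ m) n | ^ₙ≡^ᴿ x m | ^ₙ≡^ᴿ x (m ℕ.* n) = ^-assocʳ x m n

^ₙ-distrib-· : ∀ x y n → (x · y) ^ₙ n ≡ (x ^ₙ n) · (y ^ₙ n)
^ₙ-distrib-· x y n rewrite ^ₙ≡^ᴿ (x · y) n | ^ₙ≡^ᴿ x n | ^ₙ≡^ᴿ y n = ^-distrib-* x y n

one^ₙ : ∀ n → one ^ₙ n ≡ one
one^ₙ zero = refl
one^ₙ (suc n) = trans (·-identityˡ _) (one^ₙ n)

conj-· : ∀ x y → conj (x · y) ≡ conj x · conj y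
conj-· (a + b √2) (c + d √2) = cong₂ _+_√2 (re-law a b c d) (im-law a b c d)
  where
  re-law : ∀ a b c d → a * c ℤ.+ + 2 * (b * d) ≡ a * c ℤ.+ + 2 * (- b * - d)
  re-law = ℤ-Solver.solve-∀
  im-law : ∀ a b c d → - (a * d ℤ.+ b * c) ≡ a * - d ℤ.+ - b * c
  im-law = ℤ-Solver.solve-∀

conj-^ₙ : ∀ x n → conj (x ^ₙ n) ≡ conj x ^ₙ n
conj-^ₙ x zero = refl
conj-^ₙ x (suc n) = trans (conj-· x (x ^ₙ n)) (cong (conj x ·_) (conj-^ₙ x n))

N : ℤ√2 → ℤ
N (a + b √2) = a * a - + 2 * (b * b)

N-· : ∀ x y → N (x · y) ≡ N x * N y
N-· (a + b √2) (c + d √2) = law a b c d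
  where
  law : ∀ a b c d → (a * c ℤ.+ + 2 * (b * d)) * (a * c ℤ.+ + 2 * (b * d))
                    - + 2 * ((a * d ℤ.+ b * c) * (a * d ℤ.+ b * c))
                  ≡ (a * a - + 2 * (b * b)) * (c * c - + 2 * (d * d))
  law = ℤ-Solver.solve-∀

N-^ₙ : ∀ x n → N (x ^ₙ n) ≡ N x ^ n
N-^ₙ x zero = refl
N-^ₙ x (suc n) = trans (N-· x (x ^ₙ n)) (cong (N x *_) (N-^ₙ x n))

N-conj : ∀ x → N (conj x) ≡ N x
N-conj (a + b √2) = law a b
  where law : ∀ a b → a * a - + 2 * (- b * - b) ≡ a * a - + 2 * (b * b)
        law = ℤ-Solver.solve-∀

N-neg : ∀ x → N (neg x) ≡ N x
N-neg (a + b √2) = law a b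
  where law : ∀ a b → - a * - a - + 2 * (- b * - b) ≡ a * a - + 2 * (b * b)
        law = ℤ-Solver.solve-∀

·-conj : ∀ x → x · conj x ≡ fromℤ (N x)
·-conj (a + b √2) = cong₂ _+_√2 (re-law a b) (im-law a b)
  where
  re-law : ∀ a b → a * a ℤ.+ + 2 * (b * - b) ≡ a * a - + 2 * (b * b)
  re-law = ℤ-Solver.solve-∀
  im-law : ∀ a b → a * - b ℤ.+ b * a ≡ + 0
  im-law = ℤ-Solver.solve-∀

fromℤ-· : ∀ m n → fromℤ m · fromℤ n ≡ fromℤ (m * n)
fromℤ-· m n = cong₂ _+_√2 (re-law m n) (im-law m n)
  where
  re-law : ∀ m n → m * n ℤ.+ + 2 * (+ 0 * + 0) ≡ m * n
  re-law = ℤ-Solver.solve-∀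
  im-law : ∀ m n → m * + 0 ℤ.+ + 0 * n ≡ + 0
  im-law = ℤ-Solver.solve-∀

fromℤ-^ₙ : ∀ m n → fromℤ m ^ₙ n ≡ fromℤ (m ^ n)
fromℤ-^ₙ m zero = refl
fromℤ-^ₙ m (suc n) = trans (cong (fromℤ m ·_) (fromℤ-^ₙ m n)) (fromℤ-· m (m ^ n))

i*i≡+∣i∣*∣i∣ : ∀ i → i * i ≡ + (∣ i ∣ ℕ.* ∣ i ∣)
i*i≡+∣i∣*∣i∣ (+ n) = sym (ℤP.pos-* n n)
i*i≡+∣i∣*∣i∣ -[1+ n ] = ℤP.+◃n≡+n (suc n ℕ.* suc n)

m*m≡2*j⇒m≡k*2 : ∀ m j → m ℕ.* m ≡ 2 ℕ.* j → ∃[ k ] m ≡ k ℕ.* 2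
m*m≡2*j⇒m≡k*2 m j m²≡2j with [ id , id ]′ (euclidsLemma m m prime[2] (divides j (trans m²≡2j (ℕP.*-comm 2 j))))
... | divides k m≡k*2 = k , m≡k*2

[k*2]²≡2*j⇒j≡2*k² : ∀ k j → (k ℕ.* 2) ℕ.* (k ℕ.* 2) ≡ 2 ℕ.* j → j ≡ 2 ℕ.* (k ℕ.* k)
[k*2]²≡2*j⇒j≡2*k² k j [2k]²≡2j = sym (ℕP.*-cancelˡ-≡ _ _ 2 (trans (law k) [2k]²≡2j))
  where law : ∀ k → 2 ℕ.* (2 ℕ.* (k ℕ.* k)) ≡ (k ℕ.* 2) ℕ.* (k ℕ.* 2)
        law = ℕ-Solver.solve-∀

m*m≡2*n*n⇒m≡0 : ∀ m n → m ℕ.* m ≡ 2 ℕ.* (n ℕ.* n) → m ≡ 0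
m*m≡2*n*n⇒m≡0 m n = descent m n (<-wellFounded m)
  where
  descent : ∀ m n → Acc _<_ m → m ℕ.* m ≡ 2 ℕ.* (n ℕ.* n) → m ≡ 0
  descent m n (acc rec) m²≡2n² with m*m≡2*j⇒m≡k*2 m (n ℕ.* n) m²≡2n²
  ... | zero , refl = refl
  ... | suc k , refl with [k*2]²≡2*j⇒j≡2*k² (suc k) (n ℕ.* n) m²≡2n²
  ...   | n²≡2k² with m*m≡2*j⇒m≡k*2 n (suc k ℕ.* suc k) n²≡2k²
  ...     | l , refl = contradiction (descent (suc k) l (rec (ℕP.m<m*n (suc k) 2 (s≤s (s≤s z≤n))))
                                        ([k*2]²≡2*j⇒j≡2*k² l (suc k ℕ.* suc k) n²≡2k²)) λ ()

N≡0⇒≡𝟘 : ∀ x → N x ≡ + 0 → x ≡ 𝟘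
N≡0⇒≡𝟘 (a + b √2) Nx≡0 = cong₂ _+_√2 (ℤP.∣i∣≡0⇒i≡0 ∣a∣≡0) (ℤP.∣i∣≡0⇒i≡0 ∣b∣≡0)
  where
  open ≡-Reasoning
  ∣a∣²≡2∣b∣² : ∣ a ∣ ℕ.* ∣ a ∣ ≡ 2 ℕ.* (∣ b ∣ ℕ.* ∣ b ∣)
  ∣a∣²≡2∣b∣² = begin
    ∣ a ∣ ℕ.* ∣ a ∣         ≡⟨ ℤP.abs-* a a ⟨
    ∣ a * a ∣               ≡⟨ cong ∣_∣ (ℤP.i-j≡0⇒i≡j (a * a) (+ 2 * (b * b)) Nx≡0) ⟩
    ∣ + 2 * (b * b) ∣       ≡⟨ ℤP.abs-* (+ 2) (b * b) ⟩
    2 ℕ.* ∣ b * b ∣         ≡⟨ cong (2 ℕ.*_) (ℤP.abs-* b b) ⟩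
    2 ℕ.* (∣ b ∣ ℕ.* ∣ b ∣) ∎
  ∣a∣≡0 : ∣ a ∣ ≡ 0
  ∣a∣≡0 = m*m≡2*n*n⇒m≡0 ∣ a ∣ ∣ b ∣ ∣a∣²≡2∣b∣²
  ∣b∣≡0 : ∣ b ∣ ≡ 0
  ∣b∣≡0 = [ id , id ]′ (ℕP.m*n≡0⇒m≡0∨n≡0 ∣ b ∣
    (ℕP.*-cancelˡ-≡ _ 0 2 (trans (sym ∣a∣²≡2∣b∣²) (cong (λ m → m ℕ.* m) ∣a∣≡0))))

∣⇒N≢0 : ∀ {x y} → x ∣ y → N y ≢ + 0 → N x ≢ + 0
∣⇒N≢0 {x} {y} (q , qx≡y) Ny≢0 Nx≡0 = Ny≢0 (begin
  N y           ≡⟨ cong N qx≡y ⟨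
  N (q · x)     ≡⟨ N-· q x ⟩
  N q * N x     ≡⟨ cong (N q *_) Nx≡0 ⟩
  N q * + 0     ≡⟨ ℤP.*-zeroʳ (N q) ⟩
  + 0           ∎)
  where open ≡-Reasoning

N-^ₙ≢0 : ∀ x n → N x ≢ + 0 → N (x ^ₙ n) ≢ + 0
N-^ₙ≢0 x n Nx≢0 Nxⁿ≡0 = Nx≢0 (ℤP.i^n≡0⇒i≡0 (N x) n (trans (sym (N-^ₙ x n)) Nxⁿ≡0))

·-cancelʳ : ∀ {x y} z → N z ≢ + 0 → x · z ≡ y · z → x ≡ y
·-cancelʳ {x} {y} z Nz≢0 xz≡yz = x∙y⁻¹≈ε⇒x≈y x y (N≡0⇒≡𝟘 (x ⊕ neg y) N[x-y]≡0)
  where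
  open ≡-Reasoning
  [x-y]z≡𝟘 : (x ⊕ neg y) · z ≡ 𝟘
  [x-y]z≡𝟘 = begin
    (x ⊕ neg y) · z       ≡⟨ Solver.solve (x ∷ y ∷ z ∷ []) ℤ√2-ring ⟩
    x · z ⊕ neg (y · z)   ≡⟨ cong (λ w → w ⊕ neg (y · z)) xz≡yz ⟩
    y · z ⊕ neg (y · z)   ≡⟨ neg-inverseʳ (y · z) ⟩
    𝟘                     ∎
  N[x-y]≡0 : N (x ⊕ neg y) ≡ + 0
  N[x-y]≡0 = [ id , (λ Nz≡0 → contradiction Nz≡0 Nz≢0) ]′
    (ℤP.i*j≡0⇒i≡0∨j≡0 (N (x ⊕ neg y)) (trans (sym (N-· (x ⊕ neg y) z)) (cong N [x-y]z≡𝟘)))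

unit⇒∣N∣≡1 : ∀ {w} → w ∣ one → ∣ N w ∣ ≡ 1
unit⇒∣N∣≡1 {w} (v , vw≡1) = ℕP.m*n≡1⇒n≡1 ∣ N v ∣ ∣ N w ∣ (begin
  ∣ N v ∣ ℕ.* ∣ N w ∣   ≡⟨ ℤP.abs-* (N v) (N w) ⟨
  ∣ N v * N w ∣         ≡⟨ cong ∣_∣ (N-· v w) ⟨
  ∣ N (v · w) ∣         ≡⟨ cong (∣_∣ ∘ N) vw≡1 ⟩
  1                     ∎)
  where open ≡-Reasoning

∣N∣≡1⇒unit : ∀ {w} → ∣ N w ∣ ≡ 1 → w ∣ one
∣N∣≡1⇒unit {w} ∣Nw∣≡1 = fromℤ (N w) · conj w , (begin
  (fromℤ (N w) · conj w) · w       ≡⟨ ·-assoc (fromℤ (N w)) (conj w) w ⟩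
  fromℤ (N w) · (conj w · w)       ≡⟨ cong (fromℤ (N w) ·_) (trans (·-comm (conj w) w) (·-conj w)) ⟩
  fromℤ (N w) · fromℤ (N w)        ≡⟨ fromℤ-· (N w) (N w) ⟩
  fromℤ (N w * N w)                ≡⟨ cong fromℤ (i*i≡+∣i∣*∣i∣ (N w)) ⟩
  fromℤ (+ (∣ N w ∣ ℕ.* ∣ N w ∣))  ≡⟨ cong (λ n → fromℤ (+ (n ℕ.* n))) ∣Nw∣≡1 ⟩
  one                              ∎)
  where open ≡-Reasoning

Comaximal : ℤ√2 → ℤ√2 → Set
Comaximal α β = ∃[ u ] ∃[ v ] u · α ⊕ v · β ≡ one

comaximal-sym : ∀ {α β} → Comaximal α β → Comaximal β α
comaximal-sym {α} {β} (u , v , uα+vβ≡1) = v , u , trans (⊕-comm (v · β) (u · α)) uα+vβ≡1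

comaximal-∣ˡ : ∀ {δ α β} → δ ∣ α → Comaximal α β → Comaximal δ β
comaximal-∣ˡ {δ} {α} {β} (q , qδ≡α) (u , v , uα+vβ≡1) = u · q , v , (begin
  (u · q) · δ ⊕ v · β   ≡⟨ cong (_⊕ v · β) (trans (·-assoc u q δ) (cong (u ·_) qδ≡α)) ⟩
  u · α ⊕ v · β         ≡⟨ uα+vβ≡1 ⟩
  one                   ∎)
  where open ≡-Reasoning

comaximal-·ˡ : ∀ {α γ β} → Comaximal α β → Comaximal γ β → Comaximal (α · γ) β
comaximal-·ˡ {α} {γ} {β} (u , v , uα+vβ≡1) (u′ , v′ , u′γ+v′β≡1) = u · u′ , (u · α) · v′ ⊕ v , (begin
  (u · u′) · (α · γ) ⊕ ((u · α) · v′ ⊕ v) · β  ≡⟨ Solver.solve (u ∷ u′ ∷ α ∷ γ ∷ v′ ∷ v ∷ β ∷ []) ℤ√2-ring ⟩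
  (u · α) · (u′ · γ ⊕ v′ · β) ⊕ v · β          ≡⟨ cong (λ z → (u · α) · z ⊕ v · β) u′γ+v′β≡1 ⟩
  (u · α) · one ⊕ v · β                        ≡⟨ cong (_⊕ v · β) (·-identityʳ (u · α)) ⟩
  u · α ⊕ v · β                                ≡⟨ uα+vβ≡1 ⟩
  one                                          ∎)
  where open ≡-Reasoning

comaximal-^ₙˡ : ∀ {α β} n → Comaximal α β → Comaximal (α ^ₙ n) β
comaximal-^ₙˡ {β = β} zero _ = one , 𝟘 , cong (one ⊕_) (zeroˡ β)
comaximal-^ₙˡ (suc n) α⊥β = comaximal-·ˡ α⊥β (comaximal-^ₙˡ n α⊥β)

comaximal-^ₙʳ : ∀ {α β} n → Comaximal α β → Comaximal α (β ^ₙ n)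
comaximal-^ₙʳ n = comaximal-sym ∘ comaximal-^ₙˡ n ∘ comaximal-sym

comaximal-∣⇒unit : ∀ {α β} → Comaximal α β → α ∣ β → α ∣ one
comaximal-∣⇒unit {α} {β} (u , v , uα+vβ≡1) (q , qα≡β) = u ⊕ v · q , (begin
  (u ⊕ v · q) · α       ≡⟨ Solver.solve (u ∷ v ∷ q ∷ α ∷ []) ℤ√2-ring ⟩
  u · α ⊕ v · (q · α)   ≡⟨ cong (λ z → u · α ⊕ v · z) qα≡β ⟩
  u · α ⊕ v · β         ≡⟨ uα+vβ≡1 ⟩
  one                   ∎)
  where open ≡-Reasoning

comaximal-∣-·⇒∣ : ∀ {α β γ} → Comaximal α β → α ∣ γ · β → α ∣ γ
comaximal-∣-·⇒∣ {α} {β} {γ} (u , v , uα+vβ≡1) (q , qα≡γβ) = γ · u ⊕ v · q , (begin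
  (γ · u ⊕ v · q) · α           ≡⟨ Solver.solve (γ ∷ u ∷ v ∷ q ∷ α ∷ []) ℤ√2-ring ⟩
  γ · (u · α) ⊕ v · (q · α)     ≡⟨ cong (λ z → γ · (u · α) ⊕ v · z) qα≡γβ ⟩
  γ · (u · α) ⊕ v · (γ · β)     ≡⟨ Solver.solve (γ ∷ u ∷ α ∷ v ∷ β ∷ []) ℤ√2-ring ⟩
  γ · (u · α ⊕ v · β)           ≡⟨ cong (γ ·_) uα+vβ≡1 ⟩
  γ · one                       ≡⟨ ·-identityʳ γ ⟩
  γ                             ∎)
  where open ≡-Reasoning

-- Euclidean division and Bézout gcds

balanced-divMod : ∀ A n .{{_ : ℕ.NonZero n}} → ∃[ q ] ∃[ r ] A ≡ q * + n ℤ.+ r × 2 ℕ.* ∣ r ∣ ≤ n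
balanced-divMod A n with 2 ℕ.* (A ℤ.%ℕ n) ℕ.≤? n
... | yes 2r≤n = A ℤ./ℕ n , + (A ℤ.%ℕ n) ,
                 trans (a≡a%ℕn+[a/ℕn]*n A n) (ℤP.+-comm (+ (A ℤ.%ℕ n)) (A ℤ./ℕ n * + n)) , 2r≤n
... | no 2r≰n = q ℤ.+ + 1 , r ℤ.⊖ n , A≡[q+1]n+[r-n] , 2∣r-n∣≤n
  where
  q : ℤ
  q = A ℤ./ℕ n
  r : ℕ
  r = A ℤ.%ℕ n
  A≡[q+1]n+[r-n] : A ≡ (q ℤ.+ + 1) * + n ℤ.+ (r ℤ.⊖ n)
  A≡[q+1]n+[r-n] = begin
    A                                  ≡⟨ a≡a%ℕn+[a/ℕn]*n A n ⟩
    + r ℤ.+ q * + n                    ≡⟨ law (+ r) q (+ n) ⟩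
    (q ℤ.+ + 1) * + n ℤ.+ (+ r - + n)  ≡⟨ cong (λ z → (q ℤ.+ + 1) * + n ℤ.+ z) (ℤP.[+m]-[+n]≡m⊖n r n) ⟩
    (q ℤ.+ + 1) * + n ℤ.+ (r ℤ.⊖ n)    ∎
    where
    open ≡-Reasoning
    law : ∀ r q n → r ℤ.+ q * n ≡ (q ℤ.+ + 1) * n ℤ.+ (r - n)
    law = ℤ-Solver.solve-∀
  2∣r-n∣≤n : 2 ℕ.* ∣ r ℤ.⊖ n ∣ ≤ n
  2∣r-n∣≤n = begin
    2 ℕ.* ∣ r ℤ.⊖ n ∣    ≡⟨ cong (2 ℕ.*_) (ℤP.∣⊖∣-< (n%ℕd<d A n)) ⟩
    2 ℕ.* (n ∸ r)        ≡⟨ ℕP.*-distribˡ-∸ 2 n r ⟩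
    2 ℕ.* n ∸ 2 ℕ.* r    ≤⟨ ℕP.∸-monoʳ-≤ (2 ℕ.* n) (ℕP.<⇒≤ (ℕP.≰⇒> 2r≰n)) ⟩
    2 ℕ.* n ∸ n          ≡⟨ ℕP.m+n∸m≡n n (n ℕ.+ 0) ⟩
    n ℕ.+ 0              ≡⟨ ℕP.+-identityʳ n ⟩
    n                    ∎
    where open ℕP.≤-Reasoning

2*x≤m⇒x<m : ∀ x {m} → 2 ℕ.* x ≤ m → 0 < m → x < m
2*x≤m⇒x<m zero _ 0<m = 0<m
2*x≤m⇒x<m (suc x) 2x≤m _ = ℕP.<-≤-trans (ℕP.m<m+n (suc x) (s≤s z≤n)) 2x≤m

∣N∣<n² : ∀ n r₁ r₂ → 0 < n → 2 ℕ.* ∣ r₁ ∣ ≤ n → 2 ℕ.* ∣ r₂ ∣ ≤ n → ∣ N (r₁ + r₂ √2) ∣ < n ℕ.* n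
∣N∣<n² n r₁ r₂ 0<n 2∣r₁∣≤n 2∣r₂∣≤n = ℕP.≤-<-trans ∣U⊖W∣≤U⊔W (ℕP.⊔-lub U<n² W<n²)
  where
  U W : ℕ
  U = ∣ r₁ ∣ ℕ.* ∣ r₁ ∣
  W = 2 ℕ.* (∣ r₂ ∣ ℕ.* ∣ r₂ ∣)
  N≡U⊖W : N (r₁ + r₂ √2) ≡ U ℤ.⊖ W
  N≡U⊖W = begin
    r₁ * r₁ - + 2 * (r₂ * r₂)          ≡⟨ cong₂ (λ u w → u - + 2 * w) (i*i≡+∣i∣*∣i∣ r₁) (i*i≡+∣i∣*∣i∣ r₂) ⟩
    + U - + 2 * + (∣ r₂ ∣ ℕ.* ∣ r₂ ∣)  ≡⟨ cong (λ w → + U - w) (ℤP.pos-* 2 (∣ r₂ ∣ ℕ.* ∣ r₂ ∣)) ⟨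
    + U - + W                          ≡⟨ ℤP.[+m]-[+n]≡m⊖n U W ⟩
    U ℤ.⊖ W                            ∎
    where open ≡-Reasoning
  ∣U⊖W∣≤U⊔W : ∣ N (r₁ + r₂ √2) ∣ ≤ U ℕ.⊔ W
  ∣U⊖W∣≤U⊔W = subst (λ z → ∣ z ∣ ≤ U ℕ.⊔ W) (sym N≡U⊖W) (ℤP.∣m⊝n∣≤m⊔n U W)
  U<n² : U < n ℕ.* n
  U<n² = ℕP.*-mono-< (2*x≤m⇒x<m ∣ r₁ ∣ 2∣r₁∣≤n 0<n) (2*x≤m⇒x<m ∣ r₁ ∣ 2∣r₁∣≤n 0<n)
  W<n² : W < n ℕ.* n
  W<n² = 2*x≤m⇒x<m W (subst (_≤ n ℕ.* n) (law ∣ r₂ ∣) (ℕP.*-mono-≤ 2∣r₂∣≤n 2∣r₂∣≤n)) (ℕP.*-mono-< 0<n 0<n)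
    where law : ∀ v → 2 ℕ.* v ℕ.* (2 ℕ.* v) ≡ 2 ℕ.* (2 ℕ.* (v ℕ.* v))
          law = ℕ-Solver.solve-∀

_≺_ : ℤ√2 → ℤ√2 → Set
_≺_ = _<_ on (∣_∣ ∘ N)

≺-wellFounded : WellFounded _≺_
≺-wellFounded = on-wellFounded (∣_∣ ∘ N) <-wellFounded

scaled-conj : ∀ γ → ∃[ γ* ] γ · γ* ≡ fromℤ (+ ∣ N γ ∣) × ∣ N γ* ∣ ≡ ∣ N γ ∣
scaled-conj γ with ℤP.+∣i∣≡i⊎+∣i∣≡-i (N γ)
... | inj₁ +∣Nγ∣≡Nγ = conj γ , trans (·-conj γ) (cong fromℤ (sym +∣Nγ∣≡Nγ)) , cong ∣_∣ (N-conj γ)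
... | inj₂ +∣Nγ∣≡-Nγ = neg (conj γ) ,
  trans (sym (-‿distribʳ-* γ (conj γ))) (trans (cong neg (·-conj γ)) (cong fromℤ (sym +∣Nγ∣≡-Nγ))) ,
  cong ∣_∣ (trans (N-neg (conj γ)) (N-conj γ))

-- Round the coordinates of α γ* / |N γ| to the nearest integers; the errors r₁, r₂ satisfy
-- |r₁² − 2r₂²| < |N γ|², and ρ γ* = r₁ + r₂√2 for the remainder ρ.
euclidean-division : ∀ α γ → N γ ≢ + 0 → ∃[ q ] ∃[ ρ ] α ≡ q · γ ⊕ ρ × ρ ≺ γ
euclidean-division α γ Nγ≢0 with scaled-conj γ
... | γ* , γγ*≡n , ∣Nγ*∣≡n
  with balanced-divMod (re (α · γ*)) ∣ N γ ∣ {{n≢0}} | balanced-divMod (im (α · γ*)) ∣ N γ ∣ {{n≢0}}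
  where
  n≢0 : ℕ.NonZero ∣ N γ ∣
  n≢0 = ℕ.≢-nonZero (Nγ≢0 ∘ ℤP.∣i∣≡0⇒i≡0)
... | q₁ , r₁ , A≡q₁n+r₁ , 2∣r₁∣≤n | q₂ , r₂ , B≡q₂n+r₂ , 2∣r₂∣≤n = q , ρ , α≡qγ+ρ , ρ≺γ
  where
  n : ℕ
  n = ∣ N γ ∣
  q ρ : ℤ√2
  q = q₁ + q₂ √2
  ρ = α ⊕ neg (q · γ)
  α≡qγ+ρ : α ≡ q · γ ⊕ ρ
  α≡qγ+ρ = law α (q · γ)
    where law : ∀ a b → a ≡ b ⊕ (a ⊕ neg b)
          law = Solver.solve-∀ ℤ√2-ring
  ργ*≡r : ρ · γ* ≡ r₁ + r₂ √2
  ργ*≡r = begin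
    (α ⊕ neg (q · γ)) · γ*                   ≡⟨ ring-law α q γ γ* ⟩
    α · γ* ⊕ neg (q · (γ · γ*))              ≡⟨ cong (λ z → α · γ* ⊕ neg (q · z)) γγ*≡n ⟩
    α · γ* ⊕ neg (q · fromℤ (+ n))           ≡⟨ cong₂ (λ a b → (a + b √2) ⊕ neg (q · fromℤ (+ n)))
                                                      A≡q₁n+r₁ B≡q₂n+r₂ ⟩
    (q₁ * + n ℤ.+ r₁) + (q₂ * + n ℤ.+ r₂) √2
      ⊕ neg (q · fromℤ (+ n))                ≡⟨ cong₂ _+_√2 (re-law q₁ q₂ r₁ (+ n)) (im-law q₁ q₂ r₂ (+ n)) ⟩
    r₁ + r₂ √2                               ∎
    where
    open ≡-Reasoning
    ring-law : ∀ a b c d → (a ⊕ neg (b · c)) · d ≡ a · d ⊕ neg (b · (c · d))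
    ring-law = Solver.solve-∀ ℤ√2-ring
    re-law : ∀ q₁ q₂ r₁ n → (q₁ * n ℤ.+ r₁) ℤ.+ - (q₁ * n ℤ.+ + 2 * (q₂ * + 0)) ≡ r₁
    re-law = ℤ-Solver.solve-∀
    im-law : ∀ q₁ q₂ r₂ n → (q₂ * n ℤ.+ r₂) ℤ.+ - (q₁ * + 0 ℤ.+ q₂ * n) ≡ r₂
    im-law = ℤ-Solver.solve-∀
  ρ≺γ : ∣ N ρ ∣ < n
  ρ≺γ = ℕP.*-cancelʳ-< n ∣ N ρ ∣ n (begin-strict
    ∣ N ρ ∣ ℕ.* n         ≡⟨ cong (∣ N ρ ∣ ℕ.*_) ∣Nγ*∣≡n ⟨
    ∣ N ρ ∣ ℕ.* ∣ N γ* ∣  ≡⟨ ℤP.abs-* (N ρ) (N γ*) ⟨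
    ∣ N ρ * N γ* ∣        ≡⟨ cong ∣_∣ (trans (sym (N-· ρ γ*)) (cong N ργ*≡r)) ⟩
    ∣ N (r₁ + r₂ √2) ∣    <⟨ ∣N∣<n² n r₁ r₂ (ℕP.n≢0⇒n>0 (Nγ≢0 ∘ ℤP.∣i∣≡0⇒i≡0)) 2∣r₁∣≤n 2∣r₂∣≤n ⟩
    n ℕ.* n               ∎)
    where open ℕP.≤-Reasoning

record Gcd (α β : ℤ√2) : Set where
  constructor mkGcd
  field
    g      : ℤ√2
    g∣α    : g ∣ α
    g∣β    : g ∣ β
    s t    : ℤ√2
    bézout : s · α ⊕ t · β ≡ g

gcd-zero : ∀ α → Gcd α 𝟘
gcd-zero α = mkGcd α (one , ·-identityˡ α) (𝟘 , zeroˡ α) one 𝟘 (trans (⊕-identityʳ (one · α)) (·-identityˡ α))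

gcd-step : ∀ q {γ ρ} → Gcd γ ρ → Gcd (q · γ ⊕ ρ) γ
gcd-step q {γ} {ρ} (mkGcd g (c , cg≡γ) (d , dg≡ρ) s t sγ+tρ≡g) =
  mkGcd g (q · c ⊕ d , [qc+d]g≡qγ+ρ) (c , cg≡γ) t (s ⊕ neg (t · q)) bézout
  where
  open ≡-Reasoning
  [qc+d]g≡qγ+ρ : (q · c ⊕ d) · g ≡ q · γ ⊕ ρ
  [qc+d]g≡qγ+ρ = begin
    (q · c ⊕ d) · g        ≡⟨ Solver.solve (q ∷ c ∷ d ∷ g ∷ []) ℤ√2-ring ⟩
    q · (c · g) ⊕ d · g    ≡⟨ cong₂ (λ x y → q · x ⊕ y) cg≡γ dg≡ρ ⟩
    q · γ ⊕ ρ              ∎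
  bézout : t · (q · γ ⊕ ρ) ⊕ (s ⊕ neg (t · q)) · γ ≡ g
  bézout = begin
    t · (q · γ ⊕ ρ) ⊕ (s ⊕ neg (t · q)) · γ  ≡⟨ Solver.solve (t ∷ q ∷ γ ∷ ρ ∷ s ∷ []) ℤ√2-ring ⟩
    s · γ ⊕ t · ρ                            ≡⟨ sγ+tρ≡g ⟩
    g                                        ∎

gcd : ∀ α γ → Gcd α γ
gcd α γ = go α γ (≺-wellFounded γ)
  where
  go : ∀ α γ → Acc _≺_ γ → Gcd α γ
  go α γ (acc rec) with N γ ℤ.≟ + 0
  ... | yes Nγ≡0 = subst (Gcd α) (sym (N≡0⇒≡𝟘 γ Nγ≡0)) (gcd-zero α)
  ... | no Nγ≢0 = step (euclidean-division α γ Nγ≢0)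
    where
    step : ∃[ q ] ∃[ ρ ] α ≡ q · γ ⊕ ρ × ρ ≺ γ → Gcd α γ
    step (q , ρ , α≡qγ+ρ , ρ≺γ) = subst (λ a → Gcd a γ) (sym α≡qγ+ρ) (gcd-step q (go γ ρ (rec ρ≺γ)))

gcd-unit⇒comaximal : ∀ {α β} (G : Gcd α β) → Gcd.g G ∣ one → Comaximal α β
gcd-unit⇒comaximal {α} {β} (mkGcd g _ _ s t sα+tβ≡g) (g⁻¹ , g⁻¹g≡1) = g⁻¹ · s , g⁻¹ · t , (begin
  (g⁻¹ · s) · α ⊕ (g⁻¹ · t) · β  ≡⟨ Solver.solve (g⁻¹ ∷ s ∷ α ∷ t ∷ β ∷ []) ℤ√2-ring ⟩
  g⁻¹ · (s · α ⊕ t · β)          ≡⟨ cong (g⁻¹ ·_) sα+tβ≡g ⟩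
  g⁻¹ · g                        ≡⟨ g⁻¹g≡1 ⟩
  one                            ∎)
  where open ≡-Reasoning

-- Comaximal factors of a power

AssociatedToPower : ℕ → ℤ√2 → Set
AssociatedToPower p α = ∃[ w ] ∃[ δ ] w ∣ one × α ≡ w · (δ ^ₙ p)

unit⇒associatedToPower : ∀ p {w} → w ∣ one → AssociatedToPower p w
unit⇒associatedToPower p {w} w∣1 = w , one , w∣1 , sym (trans (cong (w ·_) (one^ₙ p)) (·-identityʳ w))

associatedToPower-·^ₙ : ∀ p {a} g → AssociatedToPower p a → AssociatedToPower p (a · (g ^ₙ p))
associatedToPower-·^ₙ p {a} g (w , δ , w∣1 , a≡wδᵖ) = w , δ · g , w∣1 , (begin
  a · (g ^ₙ p)                ≡⟨ cong (_· (g ^ₙ p)) a≡wδᵖ ⟩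
  (w · (δ ^ₙ p)) · (g ^ₙ p)   ≡⟨ ·-assoc w (δ ^ₙ p) (g ^ₙ p) ⟩
  w · ((δ ^ₙ p) · (g ^ₙ p))   ≡⟨ cong (w ·_) (^ₙ-distrib-· δ g p) ⟨
  w · ((δ · g) ^ₙ p)          ∎)
  where open ≡-Reasoning

proper-factor-≺ : ∀ {c g γ} → N γ ≢ + 0 → ∣ N g ∣ ≢ 1 → c · g ≡ γ → c ≺ γ
proper-factor-≺ {c} {g} {γ} Nγ≢0 ∣Ng∣≢1 cg≡γ = subst (∣ N c ∣ <_) ∣Nc∣∣Ng∣≡∣Nγ∣
  (ℕP.m<m*n ∣ N c ∣ ∣ N g ∣ {{∣Nc∣≢0}} (ℕP.≤∧≢⇒< (ℕP.n≢0⇒n>0 ∣Ng∣≢0) (∣Ng∣≢1 ∘ sym)))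
  where
  ∣Nc∣∣Ng∣≡∣Nγ∣ : ∣ N c ∣ ℕ.* ∣ N g ∣ ≡ ∣ N γ ∣
  ∣Nc∣∣Ng∣≡∣Nγ∣ = trans (sym (ℤP.abs-* (N c) (N g))) (cong ∣_∣ (trans (sym (N-· c g)) (cong N cg≡γ)))
  ∣Nc∣≢0 : ℕ.NonZero ∣ N c ∣
  ∣Nc∣≢0 = ℕ.≢-nonZero (∣⇒N≢0 (g , trans (·-comm g c) cg≡γ) Nγ≢0 ∘ ℤP.∣i∣≡0⇒i≡0)
  ∣Ng∣≢0 : ∣ N g ∣ ≢ 0
  ∣Ng∣≢0 = ∣⇒N≢0 (c , cg≡γ) Nγ≢0 ∘ ℤP.∣i∣≡0⇒i≡0

divide-out-power : ∀ p {α β γ g c} → N γ ≢ + 0 → Comaximal α β → α · β ≡ γ ^ₙ p → g ∣ α → c · g ≡ γ →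
                   ∃[ a ] α ≡ a · (g ^ₙ p) × Comaximal a β × a · β ≡ c ^ₙ p
divide-out-power p {α} {β} {γ} {g} {c} Nγ≢0 α⊥β αβ≡γᵖ g∣α cg≡γ = quotient (comaximal-∣-·⇒∣ gᵖ⊥β gᵖ∣αβ)
  where
  gᵖ⊥β : Comaximal (g ^ₙ p) β
  gᵖ⊥β = comaximal-^ₙˡ p (comaximal-∣ˡ g∣α α⊥β)
  gᵖ∣αβ : g ^ₙ p ∣ α · β
  gᵖ∣αβ = c ^ₙ p , trans (sym (^ₙ-distrib-· c g p)) (trans (cong (_^ₙ p) cg≡γ) (sym αβ≡γᵖ))
  quotient : g ^ₙ p ∣ α → ∃[ a ] α ≡ a · (g ^ₙ p) × Comaximal a β × a · β ≡ c ^ₙ p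
  quotient (a , agᵖ≡α) = a , sym agᵖ≡α , comaximal-∣ˡ (g ^ₙ p , trans (·-comm (g ^ₙ p) a) agᵖ≡α) α⊥β ,
    ·-cancelʳ (g ^ₙ p) (N-^ₙ≢0 g p (∣⇒N≢0 (c , cg≡γ) Nγ≢0)) (begin
      (a · β) · (g ^ₙ p)      ≡⟨ swap a β (g ^ₙ p) ⟩
      (a · (g ^ₙ p)) · β      ≡⟨ cong (_· β) agᵖ≡α ⟩
      α · β                   ≡⟨ αβ≡γᵖ ⟩
      γ ^ₙ p                  ≡⟨ cong (_^ₙ p) cg≡γ ⟨
      (c · g) ^ₙ p            ≡⟨ ^ₙ-distrib-· c g p ⟩
      (c ^ₙ p) · (g ^ₙ p)     ∎)
    where
    open ≡-Reasoning
    swap : ∀ x y z → (x · y) · z ≡ (x · z) · y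
    swap = Solver.solve-∀ ℤ√2-ring

comaximal-factor-of-power : ∀ p {α β} γ → N γ ≢ + 0 → Comaximal α β → α · β ≡ γ ^ₙ p →
                            AssociatedToPower p α
comaximal-factor-of-power p γ = go γ (≺-wellFounded γ)
  where
  go : ∀ {α β} γ → Acc _≺_ γ → N γ ≢ + 0 → Comaximal α β → α · β ≡ γ ^ₙ p → AssociatedToPower p α
  go {α} {β} γ (acc rec) Nγ≢0 α⊥β αβ≡γᵖ = from-gcd (gcd α γ)
    where
    from-gcd : Gcd α γ → AssociatedToPower p α
    from-gcd G@(mkGcd g g∣α (c , cg≡γ) _ _ _) with ∣ N g ∣ ℕ.≟ 1
    ... | yes ∣Ng∣≡1 = unit⇒associatedToPower p (comaximal-∣⇒unit
          (comaximal-^ₙʳ p (gcd-unit⇒comaximal G (∣N∣≡1⇒unit ∣Ng∣≡1))) (β , trans (·-comm β α) αβ≡γᵖ))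
    ... | no ∣Ng∣≢1 = from-quotient (divide-out-power p Nγ≢0 α⊥β αβ≡γᵖ g∣α cg≡γ)
      where
      from-quotient : ∃[ a ] α ≡ a · (g ^ₙ p) × Comaximal a β × a · β ≡ c ^ₙ p → AssociatedToPower p α
      from-quotient (a , α≡agᵖ , a⊥β , aβ≡cᵖ) =
        subst (AssociatedToPower p) (sym α≡agᵖ) (associatedToPower-·^ₙ p g
          (go c (rec (proper-factor-≺ {c} {g} Nγ≢0 ∣Ng∣≢1 cg≡γ)) (∣⇒N≢0 (g , trans (·-comm g c) cg≡γ) Nγ≢0)
              a⊥β aβ≡cᵖ))

-- Units

N-ℕ-coordinates : ∀ a b → N ((+ a) + (+ b) √2) ≡ (a ℕ.* a) ℤ.⊖ (2 ℕ.* (b ℕ.* b))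
N-ℕ-coordinates a b = begin
  + a * + a - + 2 * (+ b * + b)      ≡⟨ cong₂ (λ u v → u - + 2 * v) (ℤP.pos-* a a) (ℤP.pos-* b b) ⟨
  + (a ℕ.* a) - + 2 * + (b ℕ.* b)    ≡⟨ cong (λ v → + (a ℕ.* a) - v) (ℤP.pos-* 2 (b ℕ.* b)) ⟨
  + (a ℕ.* a) - + (2 ℕ.* (b ℕ.* b))  ≡⟨ ℤP.[+m]-[+n]≡m⊖n (a ℕ.* a) (2 ℕ.* (b ℕ.* b)) ⟩
  (a ℕ.* a) ℤ.⊖ (2 ℕ.* (b ℕ.* b))    ∎
  where open ≡-Reasoning

∣m⊖n∣≡1⇒n≤1+m : ∀ m n → ∣ m ℤ.⊖ n ∣ ≡ 1 → n ≤ suc m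
∣m⊖n∣≡1⇒n≤1+m m n ∣m⊖n∣≡1 with ℕP.≤-total m n
... | inj₁ m≤n = ℕP.≤-reflexive (begin
  n                ≡⟨ ℕP.m+[n∸m]≡n m≤n ⟨
  m ℕ.+ (n ∸ m)    ≡⟨ cong (m ℕ.+_) (trans (sym (ℤP.∣⊖∣-≤ m≤n)) ∣m⊖n∣≡1) ⟩
  m ℕ.+ 1          ≡⟨ ℕP.+-comm m 1 ⟩
  suc m            ∎)
  where open ≡-Reasoning
... | inj₂ n≤m = ℕP.m≤n⇒m≤1+n n≤m

-- A solution a, b > 0 of a² − 2b² = ±1 has b ≤ a < 2b, so (1 + √2)⁻¹ (a + b√2) = (2b − a) + (a − b)√2
-- is a solution with a smaller second coordinate.
pell-b≤a : ∀ a b → ∣ N ((+ a) + (+ b) √2) ∣ ≡ 1 → b ≤ a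
pell-b≤a a b ∣N∣≡1 = ℕP.≮⇒≥ λ a<b → ℕP.<-irrefl refl (b²<b² a<b)
  where
  2b²≤1+a² : 2 ℕ.* (b ℕ.* b) ≤ suc (a ℕ.* a)
  2b²≤1+a² = ∣m⊖n∣≡1⇒n≤1+m (a ℕ.* a) (2 ℕ.* (b ℕ.* b)) (trans (cong ∣_∣ (sym (N-ℕ-coordinates a b))) ∣N∣≡1)
  b²<b² : a < b → b ℕ.* b < b ℕ.* b
  b²<b² a<b = 2*x≤m⇒x<m (b ℕ.* b) (ℕP.≤-trans 2b²≤1+a² (ℕP.*-mono-< a<b a<b)) (ℕP.*-mono-< 0<b 0<b)
    where
    0<b : 0 < b
    0<b = ℕP.≤-<-trans z≤n a<b

pell-a<2b : ∀ a b → 0 < b → ∣ N ((+ a) + (+ b) √2) ∣ ≡ 1 → a < 2 ℕ.* b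
pell-a<2b a b 0<b ∣N∣≡1 =
  ℕP.≰⇒> λ 2b≤a → ℕP.<-irrefl refl (ℕP.<-≤-trans (ℕP.*-mono-< 0<b 0<b) (ℕP.≤-pred (b²<1 2b≤a)))
  where
  a²≤1+2b² : a ℕ.* a ≤ suc (2 ℕ.* (b ℕ.* b))
  a²≤1+2b² = ∣m⊖n∣≡1⇒n≤1+m (2 ℕ.* (b ℕ.* b)) (a ℕ.* a)
    (trans (ℤP.∣m⊖n∣≡∣n⊖m∣ (2 ℕ.* (b ℕ.* b)) (a ℕ.* a)) (trans (cong ∣_∣ (sym (N-ℕ-coordinates a b))) ∣N∣≡1))
  b²<1 : 2 ℕ.* b ≤ a → b ℕ.* b < 1
  b²<1 2b≤a = 2*x≤m⇒x<m (b ℕ.* b) (ℕP.+-cancelˡ-≤ (2 ℕ.* (b ℕ.* b)) _ _ (begin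
    2 ℕ.* (b ℕ.* b) ℕ.+ 2 ℕ.* (b ℕ.* b)  ≡⟨ law b ⟩
    (2 ℕ.* b) ℕ.* (2 ℕ.* b)              ≤⟨ ℕP.*-mono-≤ 2b≤a 2b≤a ⟩
    a ℕ.* a                              ≤⟨ a²≤1+2b² ⟩
    suc (2 ℕ.* (b ℕ.* b))                ≡⟨ ℕP.+-comm 1 _ ⟩
    2 ℕ.* (b ℕ.* b) ℕ.+ 1                ∎)) (s≤s z≤n)
    where
    open ℕP.≤-Reasoning
    law : ∀ b → 2 ℕ.* (b ℕ.* b) ℕ.+ 2 ℕ.* (b ℕ.* b) ≡ (2 ℕ.* b) ℕ.* (2 ℕ.* b)
    law = ℕ-Solver.solve-∀

pell-step : ∀ a b → 0 < b → ∣ N ((+ a) + (+ b) √2) ∣ ≡ 1 →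
            ∃[ c ] ∃[ d ] c < b × (+ a) + (+ b) √2 ≡ ε · ((+ d) + (+ c) √2)
pell-step a b 0<b ∣N∣≡1 = c , d , c<b , cong₂ _+_√2 (trans +a≡[c+d]+c (re-law (+ c) (+ d)))
                                                     (trans +b≡c+d (im-law (+ c) (+ d)))
  where
  c d : ℕ
  c = a ∸ b
  d = b ∸ c
  b+c≡a : b ℕ.+ c ≡ a
  b+c≡a = ℕP.m+[n∸m]≡n (pell-b≤a a b ∣N∣≡1)
  c<b : c < b
  c<b = ℕP.+-cancelˡ-< b c b
    (subst₂ _<_ (sym b+c≡a) (cong (b ℕ.+_) (ℕP.+-identityʳ b)) (pell-a<2b a b 0<b ∣N∣≡1))
  +b≡c+d : + b ≡ + c ℤ.+ + d
  +b≡c+d = trans (cong +_ (sym (ℕP.m+[n∸m]≡n (ℕP.<⇒≤ c<b)))) (ℤP.pos-+ c d)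
  +a≡[c+d]+c : + a ≡ (+ c ℤ.+ + d) ℤ.+ + c
  +a≡[c+d]+c = trans (cong +_ (sym b+c≡a)) (trans (ℤP.pos-+ b c) (cong (ℤ._+ + c) +b≡c+d))
  re-law : ∀ c d → (c ℤ.+ d) ℤ.+ c ≡ + 1 * d ℤ.+ + 2 * (+ 1 * c)
  re-law = ℤ-Solver.solve-∀
  im-law : ∀ c d → c ℤ.+ d ≡ + 1 * c ℤ.+ + 1 * d
  im-law = ℤ-Solver.solve-∀

pell-descent : ∀ a b → ∣ N ((+ a) + (+ b) √2) ∣ ≡ 1 → ∃[ k ] (+ a) + (+ b) √2 ≡ ε ^ₙ k
pell-descent a b = go a b (<-wellFounded b)
  where
  go : ∀ a b → Acc _<_ b → ∣ N ((+ a) + (+ b) √2) ∣ ≡ 1 → ∃[ k ] (+ a) + (+ b) √2 ≡ ε ^ₙ k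
  go a zero _ ∣N∣≡1 =
    0 , cong (λ m → (+ m) + (+ 0) √2) (ℕP.m*n≡1⇒m≡1 a a (trans (cong ∣_∣ (sym (N-ℕ-coordinates a 0))) ∣N∣≡1))
  go a (suc b) (acc rec) ∣N∣≡1 = descend (pell-step a (suc b) (s≤s z≤n) ∣N∣≡1)
    where
    descend : ∃[ c ] ∃[ d ] c < suc b × (+ a) + (+ suc b) √2 ≡ ε · ((+ d) + (+ c) √2) →
              ∃[ k ] (+ a) + (+ suc b) √2 ≡ ε ^ₙ k
    descend (c , d , c<b , w≡εw′) = map suc (trans w≡εw′ ∘ cong (ε ·_)) (go d c (rec c<b) (begin
      ∣ N ((+ d) + (+ c) √2) ∣                 ≡⟨ ℕP.+-identityʳ _ ⟨
      ∣ N ε ∣ ℕ.* ∣ N ((+ d) + (+ c) √2) ∣     ≡⟨ ℤP.abs-* (N ε) (N ((+ d) + (+ c) √2)) ⟨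
      ∣ N ε * N ((+ d) + (+ c) √2) ∣           ≡⟨ cong ∣_∣ (N-· ε ((+ d) + (+ c) √2)) ⟨
      ∣ N (ε · ((+ d) + (+ c) √2)) ∣           ≡⟨ cong (∣_∣ ∘ N) w≡εw′ ⟨
      ∣ N ((+ a) + (+ suc b) √2) ∣             ≡⟨ ∣N∣≡1 ⟩
      1                                        ∎))
      where open ≡-Reasoning

infix 4 _≡±_
_≡±_ : ℤ√2 → ℤ√2 → Set
x ≡± y = x ≡ y ⊎ x ≡ neg y

≡±-trans : ∀ {x y z} → x ≡± y → y ≡± z → x ≡± z
≡±-trans (inj₁ refl) y≡±z = y≡±z
≡±-trans (inj₂ refl) (inj₁ refl) = inj₂ refl
≡±-trans (inj₂ refl) (inj₂ refl) = inj₁ (-‿involutive _)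

neg-^ₙ : ∀ x n → neg x ^ₙ n ≡± x ^ₙ n
neg-^ₙ x zero = inj₁ refl
neg-^ₙ x (suc n) with neg-^ₙ x n
... | inj₁ eq = inj₂ (trans (cong (neg x ·_) eq) (sym (-‿distribˡ-* x (x ^ₙ n))))
... | inj₂ eq = inj₁ (trans (cong (neg x ·_) eq) (law x (x ^ₙ n)))
  where law : ∀ x y → neg x · neg y ≡ x · y
        law = Solver.solve-∀ ℤ√2-ring

εpow-neg : ∀ k → εpow (- + k) ≡ ε⁻¹ ^ₙ k
εpow-neg zero = refl
εpow-neg (suc k) = refl

conj-εpow : ∀ r → conj (εpow r) ≡± εpow (- r)
conj-εpow (+ k) =
  subst (conj (ε ^ₙ k) ≡±_) (sym (εpow-neg k)) (subst (_≡± ε⁻¹ ^ₙ k) (sym (conj-^ₙ ε k)) (neg-^ₙ ε⁻¹ k))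
conj-εpow -[1+ k ] = subst (_≡± ε ^ₙ suc k) (sym (conj-^ₙ ε⁻¹ (suc k))) (neg-^ₙ ε (suc k))

+∣i∣≡-i⇒i≡-+∣i∣ : ∀ {i} → + ∣ i ∣ ≡ - i → i ≡ - (+ ∣ i ∣)
+∣i∣≡-i⇒i≡-+∣i∣ {i} +∣i∣≡-i = trans (sym (ℤP.neg-involutive i)) (cong -_ (sym +∣i∣≡-i))

abs-parts : ℤ√2 → ℤ√2
abs-parts (a + b √2) = (+ ∣ a ∣) + (+ ∣ b ∣) √2

N-abs-parts : ∀ w → N (abs-parts w) ≡ N w
N-abs-parts (a + b √2) = cong₂ (λ u v → u - + 2 * v) (square a) (square b)
  where square : ∀ i → + ∣ i ∣ * + ∣ i ∣ ≡ i * i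
        square i = trans (sym (ℤP.pos-* ∣ i ∣ ∣ i ∣)) (sym (i*i≡+∣i∣*∣i∣ i))

≡±abs-parts⊎≡±conj : ∀ w → w ≡± abs-parts w ⊎ w ≡± conj (abs-parts w)
≡±abs-parts⊎≡±conj (a + b √2) with ℤP.+∣i∣≡i⊎+∣i∣≡-i a | ℤP.+∣i∣≡i⊎+∣i∣≡-i b
... | inj₁ +∣a∣≡a | inj₁ +∣b∣≡b = inj₁ (inj₁ (cong₂ _+_√2 (sym +∣a∣≡a) (sym +∣b∣≡b)))
... | inj₂ +∣a∣≡-a | inj₂ +∣b∣≡-b =
  inj₁ (inj₂ (cong₂ _+_√2 (+∣i∣≡-i⇒i≡-+∣i∣ +∣a∣≡-a) (+∣i∣≡-i⇒i≡-+∣i∣ +∣b∣≡-b)))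
... | inj₁ +∣a∣≡a | inj₂ +∣b∣≡-b = inj₂ (inj₁ (cong₂ _+_√2 (sym +∣a∣≡a) (+∣i∣≡-i⇒i≡-+∣i∣ +∣b∣≡-b)))
... | inj₂ +∣a∣≡-a | inj₁ +∣b∣≡b = inj₂ (inj₂ (cong₂ _+_√2 (+∣i∣≡-i⇒i≡-+∣i∣ +∣a∣≡-a)
                                                   (trans (sym +∣b∣≡b) (sym (ℤP.neg-involutive _)))))

unit⇒≡±εpow : ∀ w → w ∣ one → ∃[ r ] w ≡± εpow r
unit⇒≡±εpow w w∣1 = classify (≡±abs-parts⊎≡±conj w)
  (pell-descent ∣ re w ∣ ∣ im w ∣ (trans (cong ∣_∣ (N-abs-parts w)) (unit⇒∣N∣≡1 w∣1)))
  where
  classify : w ≡± abs-parts w ⊎ w ≡± conj (abs-parts w) → ∃[ k ] abs-parts w ≡ ε ^ₙ k → ∃[ r ] w ≡± εpow r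
  classify (inj₁ w≡±w′) (k , w′≡εᵏ) = + k , subst (w ≡±_) w′≡εᵏ w≡±w′
  classify (inj₂ w≡±w̄′) (k , w′≡εᵏ) =
    - + k , ≡±-trans (subst (λ z → w ≡± conj z) w′≡εᵏ w≡±w̄′) (conj-εpow (+ k))

εpow-⊖ : ∀ m n → εpow (m ℤ.⊖ n) ≡ (ε ^ₙ m) · (ε⁻¹ ^ₙ n)
εpow-⊖ m zero = sym (·-identityʳ (ε ^ₙ m))
εpow-⊖ zero (suc n) = sym (·-identityˡ (ε⁻¹ ^ₙ suc n))
εpow-⊖ (suc m) (suc n) = begin
  εpow (suc m ℤ.⊖ suc n)                ≡⟨ cong εpow (ℤP.[1+m]⊖[1+n]≡m⊖n m n) ⟩
  εpow (m ℤ.⊖ n)                        ≡⟨ εpow-⊖ m n ⟩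
  (ε ^ₙ m) · (ε⁻¹ ^ₙ n)                 ≡⟨ ·-identityˡ _ ⟨
  (ε · ε⁻¹) · ((ε ^ₙ m) · (ε⁻¹ ^ₙ n))   ≡⟨ interchange ε ε⁻¹ (ε ^ₙ m) (ε⁻¹ ^ₙ n) ⟩
  (ε ^ₙ suc m) · (ε⁻¹ ^ₙ suc n)         ∎
  where
  open ≡-Reasoning
  interchange : ∀ a b c d → (a · b) · (c · d) ≡ (a · c) · (b · d)
  interchange = Solver.solve-∀ ℤ√2-ring

εpow-+ : ∀ i j → εpow (i ℤ.+ j) ≡ εpow i · εpow j
εpow-+ (+ m) (+ n) = ^ₙ-homo-· ε m n
εpow-+ (+ m) -[1+ n ] = εpow-⊖ m (suc n)
εpow-+ -[1+ m ] (+ n) = trans (εpow-⊖ n (suc m)) (·-comm (ε ^ₙ n) (ε⁻¹ ^ₙ suc m))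
εpow-+ -[1+ m ] -[1+ n ] =
  trans (cong (λ k → ε⁻¹ ^ₙ suc k) (sym (ℕP.+-suc m n))) (^ₙ-homo-· ε⁻¹ (suc m) (suc n))

εpow-* : ∀ i n → εpow (i * + n) ≡ εpow i ^ₙ n
εpow-* i zero = cong εpow (ℤP.*-zeroʳ i)
εpow-* i (suc n) =
  trans (cong εpow (ℤP.*-suc i (+ n))) (trans (εpow-+ i (i * + n)) (cong (εpow i ·_) (εpow-* i n)))

neg-^ₙ-odd : ∀ x h → neg x ^ₙ suc (2 ℕ.* h) ≡ neg (x ^ₙ suc (2 ℕ.* h))
neg-^ₙ-odd x h = begin
  neg x · (neg x ^ₙ (2 ℕ.* h))   ≡⟨ cong (neg x ·_) (^ₙ-assocʳ (neg x) 2 h) ⟨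
  neg x · ((neg x ^ₙ 2) ^ₙ h)    ≡⟨ cong (λ y → neg x · (y ^ₙ h)) (law x) ⟩
  neg x · ((x ^ₙ 2) ^ₙ h)        ≡⟨ cong (neg x ·_) (^ₙ-assocʳ x 2 h) ⟩
  neg x · (x ^ₙ (2 ℕ.* h))       ≡⟨ -‿distribˡ-* x (x ^ₙ (2 ℕ.* h)) ⟨
  neg (x · (x ^ₙ (2 ℕ.* h)))     ∎
  where
  open ≡-Reasoning
  law : ∀ x → neg x · (neg x · one) ≡ x · (x · one)
  law = Solver.solve-∀ ℤ√2-ring

2x≤1+2h⇒x≤h : ∀ x h → 2 ℕ.* x ≤ suc (2 ℕ.* h) → x ≤ h
2x≤1+2h⇒x≤h x h 2x≤1+2h =
  ℕP.≤-pred (ℕP.*-cancelˡ-< 2 x (suc h) (ℕP.≤-trans (s≤s 2x≤1+2h) (ℕP.≤-reflexive (sym (ℕP.*-suc 2 h)))))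

reduce-exponent : ∀ h r δ {α} → α ≡ εpow r · (δ ^ₙ suc (2 ℕ.* h)) →
                  ∃[ r′ ] ∃[ δ′ ] ∣ r′ ∣ ≤ h × α ≡ εpow r′ · (δ′ ^ₙ suc (2 ℕ.* h))
reduce-exponent h r δ {α} α≡εʳδᵖ = reduce (balanced-divMod r p)
  where
  p : ℕ
  p = suc (2 ℕ.* h)
  reduce : ∃[ q ] ∃[ r′ ] r ≡ q * + p ℤ.+ r′ × 2 ℕ.* ∣ r′ ∣ ≤ p →
           ∃[ r′ ] ∃[ δ′ ] ∣ r′ ∣ ≤ h × α ≡ εpow r′ · (δ′ ^ₙ p)
  reduce (q , r′ , r≡qp+r′ , 2∣r′∣≤p) = r′ , εpow q · δ , 2x≤1+2h⇒x≤h ∣ r′ ∣ h 2∣r′∣≤p , (begin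
    α                                       ≡⟨ α≡εʳδᵖ ⟩
    εpow r · (δ ^ₙ p)                       ≡⟨ cong (λ i → εpow i · (δ ^ₙ p)) r≡qp+r′ ⟩
    εpow (q * + p ℤ.+ r′) · (δ ^ₙ p)        ≡⟨ cong (_· (δ ^ₙ p)) (εpow-+ (q * + p) r′) ⟩
    (εpow (q * + p) · εpow r′) · (δ ^ₙ p)   ≡⟨ cong (λ z → (z · εpow r′) · (δ ^ₙ p)) (εpow-* q p) ⟩
    ((εpow q ^ₙ p) · εpow r′) · (δ ^ₙ p)    ≡⟨ law (εpow q ^ₙ p) (εpow r′) (δ ^ₙ p) ⟩
    εpow r′ · ((εpow q ^ₙ p) · (δ ^ₙ p))    ≡⟨ cong (εpow r′ ·_) (^ₙ-distrib-· (εpow q) δ p) ⟨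
    εpow r′ · ((εpow q · δ) ^ₙ p)           ∎)
    where
    open ≡-Reasoning
    law : ∀ a b c → (a · b) · c ≡ b · (a · c)
    law = Solver.solve-∀ ℤ√2-ring

odd-power-normal-form : ∀ h {α} → AssociatedToPower (suc (2 ℕ.* h)) α →
                        ∃[ r ] ∃[ δ ] ∣ r ∣ ≤ h × α ≡ εpow r · (δ ^ₙ suc (2 ℕ.* h))
odd-power-normal-form h {α} (w , δ , w∣1 , α≡wδᵖ) = normalise (unit⇒≡±εpow w w∣1)
  where
  open ≡-Reasoning
  p : ℕ
  p = suc (2 ℕ.* h)
  normalise : ∃[ r ] w ≡± εpow r → ∃[ r ] ∃[ δ ] ∣ r ∣ ≤ h × α ≡ εpow r · (δ ^ₙ p)
  normalise (r , inj₁ w≡εʳ) = reduce-exponent h r δ (trans α≡wδᵖ (cong (_· (δ ^ₙ p)) w≡εʳ))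
  normalise (r , inj₂ w≡-εʳ) = reduce-exponent h r (neg δ) (begin
    α                           ≡⟨ α≡wδᵖ ⟩
    w · (δ ^ₙ p)                ≡⟨ cong (_· (δ ^ₙ p)) w≡-εʳ ⟩
    neg (εpow r) · (δ ^ₙ p)     ≡⟨ -‿distribˡ-* (εpow r) (δ ^ₙ p) ⟨
    neg (εpow r · (δ ^ₙ p))     ≡⟨ -‿distribʳ-* (εpow r) (δ ^ₙ p) ⟩
    εpow r · neg (δ ^ₙ p)       ≡⟨ cong (εpow r ·_) (neg-^ₙ-odd δ h) ⟨
    εpow r · (neg δ ^ₙ p)       ∎)

ℤ-even⊎odd : ∀ i → ∃[ k ] (i ≡ + 2 * k ⊎ i ≡ + 1 ℤ.+ + 2 * k)
ℤ-even⊎odd i = classify (i ℤ.%ℕ 2) (n%ℕd<d i 2) (a≡a%ℕn+[a/ℕn]*n i 2)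
  where
  even-law : ∀ q → + 0 ℤ.+ q * + 2 ≡ + 2 * q
  even-law = ℤ-Solver.solve-∀
  odd-law : ∀ q → + 1 ℤ.+ q * + 2 ≡ + 1 ℤ.+ + 2 * q
  odd-law = ℤ-Solver.solve-∀
  classify : ∀ r → r < 2 → i ≡ + r ℤ.+ i ℤ./ℕ 2 * + 2 → ∃[ k ] (i ≡ + 2 * k ⊎ i ≡ + 1 ℤ.+ + 2 * k)
  classify 0 _ i≡2q = i ℤ./ℕ 2 , inj₁ (trans i≡2q (even-law (i ℤ./ℕ 2)))
  classify 1 _ i≡1+2q = i ℤ./ℕ 2 , inj₂ (trans i≡1+2q (odd-law (i ℤ./ℕ 2)))
  classify (suc (suc _)) (s≤s (s≤s ())) _

prime≥3⇒odd : ∀ {p} → Prime p → 3 ≤ p → ∃[ h ] p ≡ suc (2 ℕ.* h)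
prime≥3⇒odd {p} p-prime 3≤p = classify (p ℕ.% 2) (m%n<n p 2) (m≡m%n+[m/n]*n p 2)
  where
  classify : ∀ r → r < 2 → p ≡ r ℕ.+ p / 2 ℕ.* 2 → ∃[ h ] p ≡ suc (2 ℕ.* h)
  classify 0 _ p≡2q = ⊥-elim ([ (λ ()) , (λ 2≡p → ℕP.<-irrefl 2≡p 3≤p) ]′
    (prime⇒irreducible p-prime (divides (p / 2) p≡2q)))
  classify 1 _ p≡1+2q = p / 2 , trans p≡1+2q (cong suc (ℕP.*-comm (p / 2) 2))
  classify (suc (suc _)) (s≤s (s≤s ())) _

even≢odd : ∀ k l → + 2 * k ≢ + 1 ℤ.+ + 2 * l
even≢odd k l 2k≡1+2l =
  contradiction (ℕP.m*n≡1⇒m≡1 2 ∣ k - l ∣ (trans (sym (ℤP.abs-* (+ 2) (k - l))) (cong ∣_∣ 2[k-l]≡1))) λ ()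
  where
  open ≡-Reasoning
  2[k-l]≡1 : + 2 * (k - l) ≡ + 1
  2[k-l]≡1 = begin
    + 2 * (k - l)                ≡⟨ distrib k l ⟩
    + 2 * k - + 2 * l            ≡⟨ cong (_- + 2 * l) 2k≡1+2l ⟩
    (+ 1 ℤ.+ + 2 * l) - + 2 * l  ≡⟨ cancel l ⟩
    + 1                          ∎
    where
    distrib : ∀ k l → + 2 * (k - l) ≡ + 2 * k - + 2 * l
    distrib = ℤ-Solver.solve-∀
    cancel : ∀ l → (+ 1 ℤ.+ + 2 * l) - + 2 * l ≡ + 1
    cancel = ℤ-Solver.solve-∀

odd-^ : ∀ k n → ∃[ l ] (+ 1 ℤ.+ + 2 * k) ^ n ≡ + 1 ℤ.+ + 2 * l
odd-^ k zero = + 0 , refl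
odd-^ k (suc n) = step (odd-^ k n)
  where
  step : ∃[ l ] (+ 1 ℤ.+ + 2 * k) ^ n ≡ + 1 ℤ.+ + 2 * l → ∃[ l ] (+ 1 ℤ.+ + 2 * k) ^ suc n ≡ + 1 ℤ.+ + 2 * l
  step (l , [1+2k]ⁿ≡1+2l) =
    k ℤ.+ l ℤ.+ + 2 * (k * l) , trans (cong ((+ 1 ℤ.+ + 2 * k) *_) [1+2k]ⁿ≡1+2l) (law k l)
    where law : ∀ k l → (+ 1 ℤ.+ + 2 * k) * (+ 1 ℤ.+ + 2 * l) ≡ + 1 ℤ.+ + 2 * (k ℤ.+ l ℤ.+ + 2 * (k * l))
          law = ℤ-Solver.solve-∀

-- The equation x² − 2 = yᵖ

-- For even x, x² − 2 = 2 · odd, whereas yⁿ with n ≥ 2 is odd or divisible by 4.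
[2k]²-2≢y^[2+n] : ∀ k y n → (+ 2 * k) * (+ 2 * k) - + 2 ≢ y ^ suc (suc n)
[2k]²-2≢y^[2+n] k y n x²-2≡yⁿ = by-parity (ℤ-even⊎odd y)
  where
  open ≡-Reasoning
  x²-2≡2[1+2j] : (+ 2 * k) * (+ 2 * k) - + 2 ≡ + 2 * (+ 1 ℤ.+ + 2 * (k * k - + 1))
  x²-2≡2[1+2j] = law k
    where law : ∀ k → (+ 2 * k) * (+ 2 * k) - + 2 ≡ + 2 * (+ 1 ℤ.+ + 2 * (k * k - + 1))
          law = ℤ-Solver.solve-∀
  by-parity : ∃[ m ] (y ≡ + 2 * m ⊎ y ≡ + 1 ℤ.+ + 2 * m) → ⊥
  by-parity (m , inj₁ y≡2m) = even≢odd (m * m * Y) (k * k - + 1) (sym (ℤP.*-cancelˡ-≡ (+ 2) _ _ (begin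
    + 2 * (+ 1 ℤ.+ + 2 * (k * k - + 1))   ≡⟨ x²-2≡2[1+2j] ⟨
    (+ 2 * k) * (+ 2 * k) - + 2           ≡⟨ x²-2≡yⁿ ⟩
    y * (y * y ^ n)                       ≡⟨ cong (λ z → z * (z * z ^ n)) y≡2m ⟩
    (+ 2 * m) * ((+ 2 * m) * Y)           ≡⟨ law m Y ⟩
    + 2 * (+ 2 * (m * m * Y))             ∎)))
    where
    Y : ℤ
    Y = (+ 2 * m) ^ n
    law : ∀ m Y → (+ 2 * m) * ((+ 2 * m) * Y) ≡ + 2 * (+ 2 * (m * m * Y))
    law = ℤ-Solver.solve-∀
  by-parity (m , inj₂ y≡1+2m) = odd-power (odd-^ m (suc (suc n)))
    where
    odd-power : ∃[ l ] (+ 1 ℤ.+ + 2 * m) ^ suc (suc n) ≡ + 1 ℤ.+ + 2 * l → ⊥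
    odd-power (l , yⁿ≡1+2l) = even≢odd (+ 1 ℤ.+ + 2 * (k * k - + 1)) l (begin
      + 2 * (+ 1 ℤ.+ + 2 * (k * k - + 1))   ≡⟨ x²-2≡2[1+2j] ⟨
      (+ 2 * k) * (+ 2 * k) - + 2           ≡⟨ x²-2≡yⁿ ⟩
      y ^ suc (suc n)                       ≡⟨ cong (_^ suc (suc n)) y≡1+2m ⟩
      (+ 1 ℤ.+ + 2 * m) ^ suc (suc n)       ≡⟨ yⁿ≡1+2l ⟩
      + 1 ℤ.+ + 2 * l                       ∎)

x²-2≡yⁿ⇒x-odd : ∀ {x y n} → 2 ≤ n → x * x - + 2 ≡ y ^ n → ∃[ k ] x ≡ + 1 ℤ.+ + 2 * k
x²-2≡yⁿ⇒x-odd {x} {y} {suc (suc n)} (s≤s (s≤s z≤n)) x²-2≡yⁿ = by-parity (ℤ-even⊎odd x)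
  where
  by-parity : ∃[ k ] (x ≡ + 2 * k ⊎ x ≡ + 1 ℤ.+ + 2 * k) → ∃[ k ] x ≡ + 1 ℤ.+ + 2 * k
  by-parity (k , inj₁ x≡2k) =
    ⊥-elim ([2k]²-2≢y^[2+n] k y n (subst (λ z → z * z - + 2 ≡ y ^ suc (suc n)) x≡2k x²-2≡yⁿ))
  by-parity (k , inj₂ x≡1+2k) = k , x≡1+2k

x²-2≡yⁿ⇒y≢0 : ∀ {x y n} → x * x - + 2 ≡ y ^ suc n → y ≢ + 0
x²-2≡yⁿ⇒y≢0 {x} x²-2≡0 refl = contradiction (cong im (N≡0⇒≡𝟘 (x + (+ 1) √2) x²-2≡0)) λ ()

N-fromℤ≢0 : ∀ {y} → y ≢ + 0 → N (fromℤ y) ≢ + 0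
N-fromℤ≢0 {y} y≢0 Ny≡0 = y≢0 ([ id , id ]′ (ℤP.i*j≡0⇒i≡0∨j≡0 y (trans (sym (ℤP.+-identityʳ (y * y))) Ny≡0)))

-- x = 1 + 2k gives αᾱ = 4(k² + k) − 1 and (α − ᾱ)√2 = 4, so (k² + k)√2 (α − ᾱ) − αᾱ = 1.
x-odd⇒x±√2-comaximal : ∀ {x} k → x ≡ + 1 ℤ.+ + 2 * k → Comaximal (x + (+ 1) √2) (conj (x + (+ 1) √2))
x-odd⇒x±√2-comaximal k refl =
  (- (+ 1 ℤ.+ + 2 * k)) + (k * k ℤ.+ k ℤ.+ + 1) √2 , (+ 0) + (- (k * k ℤ.+ k)) √2 ,
  cong₂ _+_√2 (re-law k) (im-law k)
  where
  re-law : ∀ k → (- (+ 1 ℤ.+ + 2 * k) * (+ 1 ℤ.+ + 2 * k) ℤ.+ + 2 * ((k * k ℤ.+ k ℤ.+ + 1) * + 1))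
                 ℤ.+ (+ 0 * (+ 1 ℤ.+ + 2 * k) ℤ.+ + 2 * (- (k * k ℤ.+ k) * - + 1)) ≡ + 1
  re-law = ℤ-Solver.solve-∀
  im-law : ∀ k → (- (+ 1 ℤ.+ + 2 * k) * + 1 ℤ.+ (k * k ℤ.+ k ℤ.+ + 1) * (+ 1 ℤ.+ + 2 * k))
                 ℤ.+ (+ 0 * - + 1 ℤ.+ - (k * k ℤ.+ k) * (+ 1 ℤ.+ + 2 * k)) ≡ + 0
  im-law = ℤ-Solver.solve-∀

x+√2-normal-form : ∀ x y h → x * x - + 2 ≡ y ^ suc (2 ℕ.* suc h) →
                   ∃[ r ] ∃[ δ ] ∣ r ∣ ≤ suc h × x + (+ 1) √2 ≡ εpow r · (δ ^ₙ suc (2 ℕ.* suc h))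
x+√2-normal-form x y h x²-2≡yᵖ = odd-power-normal-form (suc h)
  (comaximal-factor-of-power p (fromℤ y) (N-fromℤ≢0 (x²-2≡yⁿ⇒y≢0 {x} {y} {2 ℕ.* suc h} x²-2≡yᵖ)) α⊥ᾱ αᾱ≡yᵖ)
  where
  p : ℕ
  p = suc (2 ℕ.* suc h)
  α⊥ᾱ : Comaximal (x + (+ 1) √2) (conj (x + (+ 1) √2))
  α⊥ᾱ = uncurry x-odd⇒x±√2-comaximal (x²-2≡yⁿ⇒x-odd {x} {y} {p} (s≤s (s≤s z≤n)) x²-2≡yᵖ)
  αᾱ≡yᵖ : (x + (+ 1) √2) · conj (x + (+ 1) √2) ≡ fromℤ y ^ₙ p
  αᾱ≡yᵖ = trans (·-conj (x + (+ 1) √2)) (trans (cong fromℤ x²-2≡yᵖ) (sym (fromℤ-^ₙ y p)))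

conj-εpow·^ₙ : ∀ r δ n → εbarpow r · (conj δ ^ₙ n) ≡ conj (εpow r · (δ ^ₙ n))
conj-εpow·^ₙ r δ n = sym (trans (conj-· (εpow r) (δ ^ₙ n)) (cong (εbarpow r ·_) (conj-^ₙ δ n)))

⊖-conj-x+√2 : ∀ {x β} → x + (+ 1) √2 ≡ β → β ⊖ conj β ≡ (+ 0) + (+ 2) √2
⊖-conj-x+√2 {x} refl = cong (λ a → a + (+ 2) √2) (ℤP.+-inverseʳ x)

theorem3p1 : (x y : ℤ) (p : ℕ) → Prime p → 3 ≤ p → x * x - + 2 ≡ y ^ p →
    ∃[ a ] ∃[ b ] ∃[ r ] (∣ r ∣ ≤ (p ∸ 1) / 2
      × (x + (+ 1) √2) ≡ εpow r · ((a + b √2) ^ₙ p)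
      × (εpow r · ((a + b √2) ^ₙ p)) ⊖ (εbarpow r · ((a + (- b) √2) ^ₙ p)) ≡ (+ 0) + (+ 2) √2)
theorem3p1 x y p p-prime 3≤p x²-2≡yᵖ with prime≥3⇒odd p-prime 3≤p
... | zero , refl = contradiction 3≤p (ℕP.<⇒≱ (s≤s (s≤s z≤n)))
... | suc h , refl = conclude (x+√2-normal-form x y h x²-2≡yᵖ)
  where
  conclude : ∃[ r ] ∃[ δ ] ∣ r ∣ ≤ suc h × x + (+ 1) √2 ≡ εpow r · (δ ^ₙ p) →
    ∃[ a ] ∃[ b ] ∃[ r ] (∣ r ∣ ≤ (p ∸ 1) / 2
      × (x + (+ 1) √2) ≡ εpow r · ((a + b √2) ^ₙ p)
      × (εpow r · ((a + b √2) ^ₙ p)) ⊖ (εbarpow r · ((a + (- b) √2) ^ₙ p)) ≡ (+ 0) + (+ 2) √2)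
  conclude (r , δ , ∣r∣≤1+h , α≡εʳδᵖ) =
    re δ , im δ , r ,
    subst (∣ r ∣ ≤_) (sym (trans (cong (_/ 2) (ℕP.*-comm 2 (suc h))) (m*n/n≡m (suc h) 2))) ∣r∣≤1+h ,
    α≡εʳδᵖ ,
    trans (cong ((εpow r · (δ ^ₙ p)) ⊖_) (conj-εpow·^ₙ r δ p)) (⊖-conj-x+√2 α≡εʳδᵖ)
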